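{- Let $(G,\mathcal{T},k)$ be an instance of \textsc{Steiner Tree} and let $(G_R,\mathcal{T}_R,k_R)$ be the instance obtained by exhaustively applying the following rule: while $G[\mathcal{T}]$ has a connected component $C$ with more than one vertex, replace $(G,\mathcal{T},k)$ by $(G/V(C),(\mathcal{T}\setminus V(C))\cup\{v_C\},k-|V(C)|+1)$, where $G/V(C)$ is obtained by contracting $V(C)$ into a single new vertex $v_C$. If $G$ is $H_\ell$-induced-subgraph-free, then $G_R$ is $H_{\ell+1}$-induced-subgraph-free.
   Context: \textsc{Steiner Tree}: given a graph $G$, terminals $\mathcal{T}\subseteq V(G)$ and an integer $k$, decide whether $G$ has a tree containing all terminals with at most $k$ vertices. For $m\ge3$, $H_m$ is the split graph on $2m$ vertices with a clique of size $m$ and an independent set of size $m$ whose edges between the two parts form a perfect matching; a graph is $H_m$-induced-subgraph-free if it has no induced subgraph isomorphic to $H_m$. -}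

module Defs where

open import Level using (0ℓ)
open import Data.Nat using (ℕ; suc; _+_; _≤_; _<_)
open import Data.Integer as ℤ using (ℤ; +_)
open import Data.Fin using (Fin; splitAt)
open import Data.Fin.Subset using (Subset; _∈_; _∉_; _⊆_; ∣_∣)
open import Data.Sum using (_⊎_; inj₁; inj₂)
open import Data.Product using (Σ; ∃; _×_; _,_)
open import Data.Empty using (⊥)
open import Relation.Nullary using (¬_)
open import Relation.Binary.PropositionalEquality using (_≡_; _≢_)
open import Relation.Binary.Construct.Closure.ReflexiveTransitive using (Star)
open import Function.Bundles using (_⇔_)
open import Function.Definitions using (Injective)

record Graph : Set₁ where
  field
    n      : ℕ
    Adj    : Fin n → Fin n → Set
    sym    : ∀ {u v} → Adj u v → Adj v u
    irrefl : ∀ {v} → ¬ Adj v v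
open Graph public

-- Adjacency of H_m on vertex set Fin (m + m): the first m vertices form a
-- clique, the last m an independent set, and clique vertex i is matched
-- with independent vertex i.
HAdj′ : ∀ {m} → Fin m ⊎ Fin m → Fin m ⊎ Fin m → Set
HAdj′ (inj₁ i) (inj₁ j) = i ≢ j
HAdj′ (inj₁ i) (inj₂ j) = i ≡ j
HAdj′ (inj₂ i) (inj₁ j) = i ≡ j
HAdj′ (inj₂ i) (inj₂ j) = ⊥

HAdj : ∀ m → Fin (m + m) → Fin (m + m) → Set
HAdj m x y = HAdj′ {m} (splitAt m x) (splitAt m y)

HasInducedH : (G : Graph) → ℕ → Set
HasInducedH G m =
  Σ (Fin (m + m) → Fin (n G)) λ f →
    Injective _≡_ _≡_ f × (∀ x y → HAdj m x y ⇔ Adj G (f x) (f y))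

HFree : Graph → ℕ → Set
HFree G m = ¬ HasInducedH G m

data WalkIn (G : Graph) (S : Subset (n G)) : Fin (n G) → Fin (n G) → Set where
  here : ∀ {u} → u ∈ S → WalkIn G S u u
  step : ∀ {u w v} → u ∈ S → Adj G u w → WalkIn G S w v → WalkIn G S u v

IsComponent : (G : Graph) → Subset (n G) → Subset (n G) → Set
IsComponent G T C =
  C ⊆ T
  × (∃ λ v → v ∈ C)
  × (∀ u v → u ∈ C → v ∈ C → WalkIn G C u v)
  × (∀ u v → u ∈ C → v ∈ T → Adj G u v → v ∈ C)

-- G′ is (up to the renaming φ) the graph G / C obtained by contracting C into
-- a single new vertex vC.
record Contraction (G : Graph) (C : Subset (n G)) (G′ : Graph)
                   (φ : Fin (n G) → Fin (n G′)) (vC : Fin (n G′)) : Set where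
  field
    surj     : ∀ y → ∃ λ x → φ x ≡ y
    inC      : ∀ x → x ∈ C → φ x ≡ vC
    outC     : ∀ x → x ∉ C → φ x ≢ vC
    injOut   : ∀ x y → x ∉ C → y ∉ C → φ x ≡ φ y → x ≡ y
    adjacent : ∀ a b → Adj G′ a b ⇔
                 (a ≢ b × ∃ λ x → ∃ λ y → φ x ≡ a × φ y ≡ b × Adj G x y)

record Instance : Set₁ where
  constructor inst
  field
    graph : Graph
    terms : Subset (n graph)
    budget : ℤ
open Instance public

Step : Instance → Instance → Set
Step (inst G T k) (inst G′ T′ k′) =
  Σ (Subset (n G)) λ C → IsComponent G T C × 1 < ∣ C ∣ ×
  Σ (Fin (n G) → Fin (n G′)) λ φ → Σ (Fin (n G′)) λ vC →
    Contraction G C G′ φ vC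
    × (∀ a → a ∈ T′ ⇔ (a ≡ vC ⊎ ∃ λ x → x ∉ C × x ∈ T × φ x ≡ a))
    × k′ ≡ (k ℤ.- + ∣ C ∣) ℤ.+ + 1

Irreducible : Instance → Set
Irreducible (inst G T k) = ∀ C → IsComponent G T C → ∣ C ∣ ≤ 1

Reduces : Instance → Instance → Set₁
Reduces = Star Step

{-# OPTIONS --safe #-}
module Submission where

-- Contracting the components of G[T] composes to a surjection ψ : V(G) → V(G_R)
-- whose image edges are exactly the edges of G_R and which is injective on the
-- preimage of the non-terminals.  The terminals of an irreducible instance are
-- independent, so they meet the clique of an induced H_{ℓ+1} in G_R at most once;
-- deleting that clique vertex and its partner leaves an H_ℓ whose clique avoids the
-- terminals.  Its clique vertices then have unique preimages under ψ, each partner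
-- lifts to the other end of a preimage edge, and the lift is an induced H_ℓ in G.

open import Defs hiding (sym)
open import Data.Nat using (ℕ; suc; _≤_; _<_)
open import Data.Nat.Properties using (<⇒≱)
open import Data.Fin using (Fin; zero; suc; splitAt; join; punchIn)
open import Data.Fin.Properties using (splitAt-join; join-splitAt; punchIn-injective; punchInᵢ≢i; any?)
open import Data.Fin.Subset using (Subset; _∈_; _∉_; _⊂_; ⁅_⁆; ∣_∣)
open import Data.Fin.Subset.Properties
  using (_∈?_; x∈⁅y⁆⇒x≡y; x≢y⇒x∉⁅y⁆; ∣⁅x⁆∣≡1; p⊂q⇒∣p∣<∣q∣)
open import Data.Vec using (tabulate)
open import Data.Vec.Properties using (lookup∘tabulate; lookup⇒[]=; []=⇒lookup)
open import Data.Sum using (_⊎_; inj₁; inj₂)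
import Data.Sum as Sum
open import Data.Sum.Properties using (inj₁-injective; inj₂-injective)
open import Data.Product using (∃; _×_; _,_; proj₁; proj₂)
open import Function using (_∘_)
open import Function.Construct.Composition using (_⇔-∘_)
open import Function.Bundles using (_⇔_; mk⇔; Equivalence)
open import Function.Definitions using (Injective)
open import Relation.Nullary using (¬_; Dec; yes; no; does)
open import Relation.Nullary.Decidable using (dec-true; ¬¬-excluded-middle)
open import Relation.Nullary.Negation using (DoubleNegation)
open import Relation.Binary.PropositionalEquality
  using (_≡_; _≢_; refl; sym; trans; cong; subst; subst₂; module ≡-Reasoning)
open import Relation.Binary.Construct.Closure.ReflexiveTransitive using (ε; _◅_)
open Equivalence using (to; from)

decSubset : ∀ {n} {P : Fin n → Set} → (∀ i → Dec (P i)) → Subset n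
decSubset P? = tabulate (λ i → does (P? i))

module _ {n} {P : Fin n → Set} (P? : ∀ i → Dec (P i)) where

  ∈-decSubset⁺ : ∀ {i} → P i → i ∈ decSubset P?
  ∈-decSubset⁺ {i} p = lookup⇒[]= i _ (trans (lookup∘tabulate _ i) (dec-true (P? i) p))

  ∈-decSubset⁻ : ∀ {i} → i ∈ decSubset P? → P i
  ∈-decSubset⁻ {i} i∈ with P? i | trans (sym (lookup∘tabulate (λ j → does (P? j)) i)) ([]=⇒lookup i∈)
  ... | yes p | _  = p
  ... | no _  | ()

¬¬-decidable : ∀ {n} (P : Fin n → Set) → DoubleNegation (∀ i → Dec (P i))
¬¬-decidable {0} P k = k (λ ())
¬¬-decidable {suc n} P k =
  ¬¬-excluded-middle λ P0? → ¬¬-decidable (P ∘ suc) λ Psuc? →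
    k λ { zero → P0? ; (suc i) → Psuc? i }

module _ {G : Graph} {S : Subset (n G)} where

  start∈ : ∀ {u v} → WalkIn G S u v → u ∈ S
  start∈ (here u∈) = u∈
  start∈ (step u∈ _ _) = u∈

  end∈ : ∀ {u v} → WalkIn G S u v → v ∈ S
  end∈ (here v∈) = v∈
  end∈ (step _ _ p) = end∈ p

  _◅◅_ : ∀ {u v w} → WalkIn G S u v → WalkIn G S v w → WalkIn G S u w
  here _ ◅◅ q = q
  step u∈ e p ◅◅ q = step u∈ e (p ◅◅ q)

  reverse : ∀ {u v} → WalkIn G S u v → WalkIn G S v u
  reverse (here u∈) = here u∈
  reverse (step u∈ e p) = reverse p ◅◅ step (start∈ p) (Graph.sym G e) (here u∈)

module Reachable (G : Graph) (T : Subset (n G)) (u : Fin (n G))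
                 (reach? : ∀ w → Dec (WalkIn G T u w)) where

  component : Subset (n G)
  component = decSubset reach?

  reached : ∀ {w} → WalkIn G T u w → w ∈ component
  reached = ∈-decSubset⁺ reach?

  walk-from-root : ∀ {w} → w ∈ component → WalkIn G T u w
  walk-from-root = ∈-decSubset⁻ reach?

  walk-in-component : ∀ {v w} → WalkIn G T u v → WalkIn G T v w → WalkIn G component v w
  walk-in-component p (here _) = here (reached p)
  walk-in-component p (step v∈ e q) =
    step (reached p) e (walk-in-component (p ◅◅ step v∈ e (here (start∈ q))) q)

  ⁅root⁆⊂component : ∀ {v} → u ∈ T → v ∈ T → Adj G u v → ⁅ u ⁆ ⊂ component
  ⁅root⁆⊂component {v} u∈ v∈ e =
      (λ x∈ → subst (_∈ component) (sym (x∈⁅y⁆⇒x≡y u x∈)) (reached (here u∈)))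
    , v , reached (step u∈ e (here v∈)) , x≢y⇒x∉⁅y⁆ v≢u
    where
    v≢u : v ≢ u
    v≢u refl = irrefl G e

  1<∣component∣ : ∀ {v} → u ∈ T → v ∈ T → Adj G u v → 1 < ∣ component ∣
  1<∣component∣ u∈ v∈ e = subst (_< _) (∣⁅x⁆∣≡1 u) (p⊂q⇒∣p∣<∣q∣ (⁅root⁆⊂component u∈ v∈ e))

  isComponent : u ∈ T → IsComponent G T component
  isComponent u∈ =
      (end∈ ∘ walk-from-root)
    , (u , reached (here u∈))
    , (λ a b a∈ b∈ → reverse (from-root a∈) ◅◅ from-root b∈)
    , (λ a b a∈ b∈T e → reached (walk-from-root a∈ ◅◅ step (end∈ (walk-from-root a∈)) e (here b∈T)))
    where
    from-root : ∀ {w} → w ∈ component → WalkIn G component u w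
    from-root = walk-in-component (here u∈) ∘ walk-from-root

Independent : (G : Graph) → Subset (n G) → Set
Independent G T = ∀ {u v} → u ∈ T → v ∈ T → ¬ Adj G u v

-- Reachability in G[T] is not decidable constructively, but the goal ⊥ is stable under double negation.
irreducible⇒independent : ∀ R → Irreducible R → Independent (graph R) (terms R)
irreducible⇒independent (inst G T _) irr {u} u∈ v∈ e =
  ¬¬-decidable (WalkIn G T u) λ reach? →
    let open Reachable G T u reach?
    in <⇒≱ (1<∣component∣ u∈ v∈ e) (irr component (isComponent u∈))

ImageAdjacency : (G G′ : Graph) → (Fin (n G) → Fin (n G′)) → Set
ImageAdjacency G G′ φ = ∀ a b → Adj G′ a b ⇔
  (a ≢ b × ∃ λ x → ∃ λ y → φ x ≡ a × φ y ≡ b × Adj G x y)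

imageAdjacency-∘ : ∀ {G₁ G₂ G₃ φ ψ} → ImageAdjacency G₁ G₂ φ → ImageAdjacency G₂ G₃ ψ →
                   ImageAdjacency G₁ G₃ (ψ ∘ φ)
imageAdjacency-∘ {G₁} {_} {G₃} {φ} {ψ} adj₁₂ adj₂₃ a b = mk⇔ forth back
  where
  Lifted : Set
  Lifted = a ≢ b × ∃ λ x → ∃ λ y → ψ (φ x) ≡ a × ψ (φ y) ≡ b × Adj G₁ x y
  forth : Adj G₃ a b → Lifted
  forth e with to (adj₂₃ a b) e
  ... | a≢b , x′ , y′ , refl , refl , e′ with to (adj₁₂ x′ y′) e′
  ...   | _ , x , y , refl , refl , e″ = a≢b , x , y , refl , refl , e″
  back : Lifted → Adj G₃ a b
  back (a≢b , x , y , refl , refl , e) =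
    from (adj₂₃ a b) (a≢b , φ x , φ y , refl , refl ,
      from (adj₁₂ (φ x) (φ y)) ((a≢b ∘ cong ψ) , x , y , refl , refl , e))

-- The composite of the contraction maps of a reduction sequence.
record Collapse (I R : Instance) : Set where
  field
    ψ                 : Fin (n (graph I)) → Fin (n (graph R))
    surjective        : ∀ y → ∃ λ x → ψ x ≡ y
    adjacency         : ImageAdjacency (graph I) (graph R) ψ
    terms-preserved   : ∀ x → x ∈ terms I → ψ x ∈ terms R
    injective-outside : ∀ x y → ψ x ∉ terms R → ψ x ≡ ψ y → x ≡ y

collapse-refl : ∀ I → Collapse I I
collapse-refl (inst G T _) = record
  { ψ = λ x → x
  ; surjective = λ y → y , refl
  ; adjacency = λ a b → mk⇔
      (λ e → (λ { refl → irrefl G e }) , a , b , refl , refl , e)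
      (λ { (_ , x , y , refl , refl , e) → e })
  ; terms-preserved = λ _ x∈ → x∈
  ; injective-outside = λ _ _ _ x≡y → x≡y
  }

collapse-step : ∀ {I J R} → Step I J → Collapse J R → Collapse I R
collapse-step {inst G T _} {inst G′ T′ _} {R} (C , _ , _ , φ , vC , con , terms′ , _) col = record
  { ψ = ψ ∘ φ
  ; surjective = λ z → let y , ψy≡z = surjective z ; x , φx≡y = Contraction.surj con y
                       in x , trans (cong ψ φx≡y) ψy≡z
  ; adjacency = imageAdjacency-∘ {G} {G′} {graph R} {φ} {ψ} (Contraction.adjacent con) adjacency
  ; terms-preserved = λ x x∈ → terms-preserved (φ x) (φ-preserves-terms x x∈)
  ; injective-outside = injective-outside′
  }
  where
  open Collapse col
  vC∈T′ : vC ∈ T′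
  vC∈T′ = from (terms′ vC) (inj₁ refl)
  φ-preserves-terms : ∀ x → x ∈ T → φ x ∈ T′
  φ-preserves-terms x x∈ with x ∈? C
  ... | yes x∈C = subst (_∈ T′) (sym (Contraction.inC con x x∈C)) vC∈T′
  ... | no x∉C = from (terms′ (φ x)) (inj₂ (x , x∉C , x∈ , refl))
  ψφ∉⇒∉C : ∀ {x y} → ψ (φ x) ∉ terms R → φ x ≡ φ y → y ∉ C
  ψφ∉⇒∉C {x} ∉R φx≡φy y∈C =
    ∉R (terms-preserved (φ x) (subst (_∈ T′) (sym (trans φx≡φy (Contraction.inC con _ y∈C))) vC∈T′))
  injective-outside′ : ∀ x y → ψ (φ x) ∉ terms R → ψ (φ x) ≡ ψ (φ y) → x ≡ y
  injective-outside′ x y ∉R eq =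
    Contraction.injOut con x y (ψφ∉⇒∉C ∉R refl) (ψφ∉⇒∉C ∉R φx≡φy) φx≡φy
    where φx≡φy = injective-outside (φ x) (φ y) ∉R eq

reduces⇒collapse : ∀ {I R} → Reduces I R → Collapse I R
reduces⇒collapse {I} ε = collapse-refl I
reduces⇒collapse (s ◅ ss) = collapse-step s (reduces⇒collapse ss)

record InducedH (G : Graph) (m : ℕ) : Set where
  field
    vertex    : Fin m ⊎ Fin m → Fin (n G)
    injective : Injective _≡_ _≡_ vertex
    adjacent  : ∀ s t → HAdj′ s t ⇔ Adj G (vertex s) (vertex t)

hasInducedH⇒inducedH : ∀ {G m} → HasInducedH G m → InducedH G m
hasInducedH⇒inducedH {G} {m} (f , f-injective , f-adjacent) = record
  { vertex = f ∘ join m m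
  ; injective = λ {s} {t} eq → begin
      s                          ≡⟨ sym (splitAt-join m m s) ⟩
      splitAt m (join m m s)     ≡⟨ cong (splitAt m) (f-injective eq) ⟩
      splitAt m (join m m t)     ≡⟨ splitAt-join m m t ⟩
      t                          ∎
  ; adjacent = λ s t → subst₂ (λ s′ t′ → HAdj′ s′ t′ ⇔ Adj G (f (join m m s)) (f (join m m t)))
                              (splitAt-join m m s) (splitAt-join m m t)
                              (f-adjacent (join m m s) (join m m t))
  }
  where open ≡-Reasoning

inducedH⇒hasInducedH : ∀ {G m} → InducedH G m → HasInducedH G m
inducedH⇒hasInducedH {m = m} h =
    vertex ∘ splitAt m
  , (λ {x} {y} eq → begin
      x                          ≡⟨ sym (join-splitAt m m x) ⟩
      join m m (splitAt m x)     ≡⟨ cong (join m m) (injective eq) ⟩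
      join m m (splitAt m y)     ≡⟨ join-splitAt m m y ⟩
      y                          ∎)
  , (λ x y → adjacent (splitAt m x) (splitAt m y))
  where
  open InducedH h
  open ≡-Reasoning

punchInPair : ∀ {ℓ} → Fin (suc ℓ) → Fin ℓ ⊎ Fin ℓ → Fin (suc ℓ) ⊎ Fin (suc ℓ)
punchInPair j = Sum.map (punchIn j) (punchIn j)

punchInPair-injective : ∀ {ℓ} (j : Fin (suc ℓ)) → Injective _≡_ _≡_ (punchInPair j)
punchInPair-injective j {inj₁ i} {inj₁ k} eq = cong inj₁ (punchIn-injective j i k (inj₁-injective eq))
punchInPair-injective j {inj₂ i} {inj₂ k} eq = cong inj₂ (punchIn-injective j i k (inj₂-injective eq))

HAdj′-punchInPair : ∀ {ℓ} (j : Fin (suc ℓ)) s t → HAdj′ s t ⇔ HAdj′ (punchInPair j s) (punchInPair j t)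
HAdj′-punchInPair j (inj₁ i) (inj₁ k) = mk⇔ (λ i≢k → i≢k ∘ punchIn-injective j i k) (λ ≢ → ≢ ∘ cong (punchIn j))
HAdj′-punchInPair j (inj₁ i) (inj₂ k) = mk⇔ (cong (punchIn j)) (punchIn-injective j i k)
HAdj′-punchInPair j (inj₂ i) (inj₁ k) = mk⇔ (cong (punchIn j)) (punchIn-injective j i k)
HAdj′-punchInPair j (inj₂ i) (inj₂ k) = mk⇔ (λ ()) (λ ())

deletePair : ∀ {G ℓ} → InducedH G (suc ℓ) → Fin (suc ℓ) → InducedH G ℓ
deletePair h j = record
  { vertex = vertex ∘ punchInPair j
  ; injective = punchInPair-injective j ∘ injective
  ; adjacent = λ s t → adjacent (punchInPair j s) (punchInPair j t) ⇔-∘ HAdj′-punchInPair j s t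
  }
  where open InducedH h

independent⇒cliqueOutside : ∀ {G T ℓ} → Independent G T → InducedH G (suc ℓ) →
  ∃ λ (h : InducedH G ℓ) → ∀ i → InducedH.vertex h (inj₁ i) ∉ T
independent⇒cliqueOutside {T = T} independent h with any? (λ i → InducedH.vertex h (inj₁ i) ∈? T)
... | yes (j , j∈) = deletePair h j , λ i i∈ →
        independent j∈ i∈ (to (InducedH.adjacent h (inj₁ j) (inj₁ (punchIn j i))) (punchInᵢ≢i j i ∘ sym))
... | no ∄ = deletePair h zero , λ i i∈ → ∄ (punchIn zero i , i∈)

lift-inducedH : ∀ {I R ℓ} → Collapse I R → (h : InducedH (graph R) ℓ) →
                (∀ i → InducedH.vertex h (inj₁ i) ∉ terms R) → InducedH (graph I) ℓ
lift-inducedH {I} {R} {ℓ} col h clique∉ = record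
  { vertex = lift
  ; injective = λ {s} {t} eq → H.injective (trans (sym (ψ∘lift s)) (trans (cong ψ eq) (ψ∘lift t)))
  ; adjacent = λ s t → mk⇔ (lift-preserves s t) (lift-reflects s t)
  }
  where
  open Collapse col
  module H = InducedH h
  G = graph I

  clique : Fin ℓ → Fin (n G)
  clique i = proj₁ (surjective (H.vertex (inj₁ i)))

  ψ∘clique : ∀ i → ψ (clique i) ≡ H.vertex (inj₁ i)
  ψ∘clique i = proj₂ (surjective (H.vertex (inj₁ i)))

  clique-unique : ∀ i {x} → ψ x ≡ H.vertex (inj₁ i) → x ≡ clique i
  clique-unique i ψx≡ = sym (injective-outside (clique i) _
    (λ ∈R → clique∉ i (subst (_∈ terms R) (ψ∘clique i) ∈R)) (trans (ψ∘clique i) (sym ψx≡)))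

  adjacent-lift : ∀ s t → Adj (graph R) (H.vertex s) (H.vertex t) →
                  ∃ λ x → ∃ λ y → ψ x ≡ H.vertex s × ψ y ≡ H.vertex t × Adj G x y
  adjacent-lift s t e = proj₂ (to (adjacency _ _) e)

  matched-edge : ∀ i → ∃ λ x → ∃ λ y →
                 ψ x ≡ H.vertex (inj₂ i) × ψ y ≡ H.vertex (inj₁ i) × Adj G x y
  matched-edge i = adjacent-lift (inj₂ i) (inj₁ i) (to (H.adjacent (inj₂ i) (inj₁ i)) refl)

  partner : Fin ℓ → Fin (n G)
  partner i = proj₁ (matched-edge i)

  ψ∘partner : ∀ i → ψ (partner i) ≡ H.vertex (inj₂ i)
  ψ∘partner i = proj₁ (proj₂ (proj₂ (matched-edge i)))

  partner-adjacent : ∀ i → Adj G (partner i) (clique i)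
  partner-adjacent i with matched-edge i
  ... | x , y , _ , ψy≡ , e = subst (Adj G x) (clique-unique i ψy≡) e

  lift : Fin ℓ ⊎ Fin ℓ → Fin (n G)
  lift (inj₁ i) = clique i
  lift (inj₂ i) = partner i

  ψ∘lift : ∀ s → ψ (lift s) ≡ H.vertex s
  ψ∘lift (inj₁ i) = ψ∘clique i
  ψ∘lift (inj₂ i) = ψ∘partner i

  lift-preserves : ∀ s t → HAdj′ s t → Adj G (lift s) (lift t)
  lift-preserves (inj₁ i) (inj₁ k) i≢k
    with adjacent-lift (inj₁ i) (inj₁ k) (to (H.adjacent (inj₁ i) (inj₁ k)) i≢k)
  ... | x , y , ψx≡ , ψy≡ , e = subst₂ (Adj G) (clique-unique i ψx≡) (clique-unique k ψy≡) e
  lift-preserves (inj₁ i) (inj₂ k) refl = Graph.sym G (partner-adjacent i)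
  lift-preserves (inj₂ i) (inj₁ k) refl = partner-adjacent i

  lift-reflects : ∀ s t → Adj G (lift s) (lift t) → HAdj′ s t
  lift-reflects s t e = from (H.adjacent s t) (from (adjacency _ _)
    (s≢t ∘ H.injective , lift s , lift t , ψ∘lift s , ψ∘lift t , e))
    where
    s≢t : s ≢ t
    s≢t refl = irrefl G e

lemma21 : (ℓ : ℕ) → 3 ≤ ℓ → (I R : Instance) → Reduces I R → Irreducible R →
            HFree (graph I) ℓ → HFree (graph R) (suc ℓ)
lemma21 ℓ _ I R I↝R irreducible free hasH
  with independent⇒cliqueOutside (irreducible⇒independent R irreducible) (hasInducedH⇒inducedH hasH)
... | h , clique∉ = free (inducedH⇒hasInducedH (lift-inducedH (reduces⇒collapse I↝R) h clique∉))
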